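{- For positive integers $m,n,r$, \begin{align*} \sum_{a=1}^{m-r}\sum_{b=1}^{n-r}\binom{2m-a+b-1}{m-r-a}\binom{2n+a-b-1}{n-r-b} &=\frac{mn}{2(m+n)}\binom{2m}{m}\binom{2n}{n}-\frac{r}{2}\binom{2m+2n}{m+n}+\frac{r}{2}\binom{2m}{m}\binom{2n}{n}\\ &\quad+\sum_{k=1}^{r-1}(r-k)\binom{2m}{m-k}\binom{2n}{n-k}. \end{align*}
   Context: Binomial coefficients $\binom{N}{k}$ are $0$ when $k<0$ or $k>N\ge0$. A sum whose upper limit is smaller than its lower limit is empty and equals $0$. -}

module Defs where

open import Data.Nat using (ℕ; zero; suc; _+_; _*_; _≤_; s≤s; NonZero)
open import Data.Rational using (ℚ; 0ℚ) renaming (_+_ to _+q_)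

sum1 : ℕ → (ℕ → ℚ) → ℚ
sum1 zero    f = 0ℚ
sum1 (suc N) f = sum1 N f +q f (suc N)

nz2mn : (m n : ℕ) → 1 ≤ m → NonZero (2 * (m + n))
nz2mn (suc m) n _ = _

open import Data.Integer using (ℤ; +_; -[1+_])
open import Data.Nat.Combinatorics using (_C_)

-- binomial coefficient with integer lower index: N choose k, = 0 for k < 0
-- (and, via _C_, = 0 for k > N)
binomℤ : ℕ → ℤ → ℕ
binomℤ N (+ k)     = N C k
binomℤ N -[1+ k ]  = 0

module Submission where

-- Reindex the double sum by i = m − r − a, j = n − r − b.  Its terms become
-- F i j = C(T − j + i, i) · C(T − i + j, j) with T = m + n − 1, summed over the rectangle
-- [0, m − r) × [0, n − r).  Enlarging a rectangle by one row and one column adds a hook, and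
-- enlarging a hook in the same way adds a single product P(k) = C(2m, m + k) · C(2n, n + k):
-- the row sums of F telescope, and the four new corner terms factor by Pascal's rule in each
-- factor.  Hence the double sum is W(r) = Σ_{k>r} (k − r) P(k), and the closed form follows from
--   2(m + n) Σ_k k P(k) = mn P(0), by telescoping with (m − k)(n − k) P(k);
--   C(2m + 2n, m + n) = P(0) + 2 Σ_{k≥1} P(k), by Vandermonde's convolution;
--   W(r) + r Σ_{k≥1} P(k) = W(0) + Σ_{k<r} (r − k) P(k), as (k − r)⁺ + r = k + (r − k)⁺.

open import Defs

module BinomialSums where
  open import Data.Nat
  open import Data.Nat.Properties
  open import Data.Nat.Combinatorics using (_C_; nCk+nC[k+1]≡[n+1]C[k+1]; nCk≡nC[n∸k]; nC1≡n; nCn≡1)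
  open import Data.Nat.Combinatorics.Specification using (k>n⇒nCk≡0)
  open import Data.Nat.Tactic.RingSolver using (solve-∀)
  open import Data.Product using (_,_)
  open import Data.Sum using (inj₁; inj₂)
  open import Function.Base using (_∘_)
  open import Relation.Binary.PropositionalEquality
  open import Relation.Nullary using (yes; no)
  open ≡-Reasoning

  +⇒∸ : ∀ {x y z} → y + z ≡ x → x ∸ y ≡ z
  +⇒∸ {y = y} {z} refl = m+n∸m≡n y z

  ∸-+-swap : ∀ x r → (x ∸ r) + r ≡ x + (r ∸ x)
  ∸-+-swap zero    r       = cong (_+ r) (0∸n≡0 r)
  ∸-+-swap (suc x) zero    = refl
  ∸-+-swap (suc x) (suc r) = trans (+-suc (x ∸ r) r) (cong suc (∸-+-swap x r))

  ∑< : ℕ → (ℕ → ℕ) → ℕ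
  ∑< zero    f = 0
  ∑< (suc n) f = ∑< n f + f n

  ∑<-cong : ∀ n {f g : ℕ → ℕ} → (∀ i → i < n → f i ≡ g i) → ∑< n f ≡ ∑< n g
  ∑<-cong zero    f≗g = refl
  ∑<-cong (suc n) f≗g = cong₂ _+_ (∑<-cong n (λ i i<n → f≗g i (m<n⇒m<1+n i<n))) (f≗g n ≤-refl)

  ∑<-≡0 : ∀ n {f : ℕ → ℕ} → (∀ i → i < n → f i ≡ 0) → ∑< n f ≡ 0
  ∑<-≡0 zero    f≡0 = refl
  ∑<-≡0 (suc n) f≡0 = cong₂ _+_ (∑<-≡0 n (λ i i<n → f≡0 i (m<n⇒m<1+n i<n))) (f≡0 n ≤-refl)

  ∑<-+ : ∀ n (f g : ℕ → ℕ) → ∑< n (λ i → f i + g i) ≡ ∑< n f + ∑< n g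
  ∑<-+ zero    f g = refl
  ∑<-+ (suc n) f g = begin
    ∑< n (λ i → f i + g i) + (f n + g n) ≡⟨ cong (_+ (f n + g n)) (∑<-+ n f g) ⟩
    ∑< n f + ∑< n g + (f n + g n)        ≡⟨ interchange (∑< n f) (∑< n g) (f n) (g n) ⟩
    ∑< n f + f n + (∑< n g + g n)        ∎
    where
    interchange : ∀ a b c d → a + b + (c + d) ≡ a + c + (b + d)
    interchange = solve-∀

  *-distribˡ-∑< : ∀ c n (f : ℕ → ℕ) → c * ∑< n f ≡ ∑< n (λ i → c * f i)
  *-distribˡ-∑< c zero    f = *-zeroʳ c
  *-distribˡ-∑< c (suc n) f =
    trans (*-distribˡ-+ c (∑< n f) (f n)) (cong (_+ c * f n) (*-distribˡ-∑< c n f))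

  ∑<-uncons : ∀ n (f : ℕ → ℕ) → ∑< (suc n) f ≡ f 0 + ∑< n (f ∘ suc)
  ∑<-uncons zero    f = +-comm 0 (f 0)
  ∑<-uncons (suc n) f = trans (cong (_+ f (suc n)) (∑<-uncons n f)) (+-assoc (f 0) _ _)

  ∑<-shift : ∀ n (f : ℕ → ℕ) → f n ≡ 0 → ∑< n f ≡ f 0 + ∑< n (f ∘ suc)
  ∑<-shift n f fn≡0 = begin
    ∑< n f                ≡⟨ +-identityʳ _ ⟨
    ∑< n f + 0            ≡⟨ cong (∑< n f +_) fn≡0 ⟨
    ∑< (suc n) f          ≡⟨ ∑<-uncons n f ⟩
    f 0 + ∑< n (f ∘ suc)  ∎

  ∑<-split : ∀ p q (f : ℕ → ℕ) → ∑< (p + q) f ≡ ∑< p f + ∑< q (λ i → f (p + i))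
  ∑<-split p zero    f = trans (cong (λ k → ∑< k f) (+-identityʳ p)) (sym (+-identityʳ (∑< p f)))
  ∑<-split p (suc q) f = begin
    ∑< (p + suc q) f                             ≡⟨ cong (λ k → ∑< k f) (+-suc p q) ⟩
    ∑< (p + q) f + f (p + q)                     ≡⟨ cong (_+ f (p + q)) (∑<-split p q f) ⟩
    ∑< p f + ∑< q (λ i → f (p + i)) + f (p + q) ≡⟨ +-assoc (∑< p f) _ _ ⟩
    ∑< p f + ∑< (suc q) (λ i → f (p + i))       ∎

  ∑<-extend : ∀ {K L} (f : ℕ → ℕ) → K ≤ L → (∀ i → K ≤ i → f i ≡ 0) → ∑< L f ≡ ∑< K f
  ∑<-extend {K} f K≤L f≡0 with m≤n⇒∃[o]m+o≡n K≤L
  ... | d , refl = begin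
    ∑< (K + d) f                     ≡⟨ ∑<-split K d f ⟩
    ∑< K f + ∑< d (λ i → f (K + i))  ≡⟨ cong (∑< K f +_) (∑<-≡0 d (λ i _ → f≡0 (K + i) (m≤m+n K i))) ⟩
    ∑< K f + 0                       ≡⟨ +-identityʳ _ ⟩
    ∑< K f                           ∎

  ∑<-reverse : ∀ n (f : ℕ → ℕ) → ∑< n f ≡ ∑< n (λ i → f (n ∸ suc i))
  ∑<-reverse zero    f = refl
  ∑<-reverse (suc n) f = begin
    ∑< (suc n) f                            ≡⟨ ∑<-uncons n f ⟩
    f 0 + ∑< n (f ∘ suc)                    ≡⟨ cong (f 0 +_) (∑<-reverse n (f ∘ suc)) ⟩
    f 0 + ∑< n (λ i → f (suc (n ∸ suc i)))  ≡⟨ cong₂ _+_ (cong f (sym (n∸n≡0 n)))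
                                                 (∑<-cong n (λ i i<n → cong f (sym (+-∸-assoc 1 i<n)))) ⟩
    f (n ∸ n) + ∑< n (λ i → f (n ∸ i))      ≡⟨ +-comm (f (n ∸ n)) _ ⟩
    ∑< (suc n) (λ i → f (suc n ∸ suc i))    ∎

  ∑<-telescope : ∀ (a e : ℕ → ℕ) → (∀ k → a k + e (suc k) ≡ e k) → ∀ d → ∑< d a + e d ≡ e 0
  ∑<-telescope a e step zero    = refl
  ∑<-telescope a e step (suc d) = begin
    ∑< d a + a d + e (suc d)    ≡⟨ +-assoc (∑< d a) (a d) _ ⟩
    ∑< d a + (a d + e (suc d))  ≡⟨ cong (∑< d a +_) (step d) ⟩
    ∑< d a + e d                ≡⟨ ∑<-telescope a e step d ⟩
    e 0                         ∎

  C-sym : ∀ {N} a b → a + b ≡ N → N C a ≡ N C b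
  C-sym a b refl = trans (nCk≡nC[n∸k] (m≤m+n a b)) (cong ((a + b) C_) (m+n∸m≡n a b))

  paths : ℕ → ℕ → ℕ
  paths u i = (u + i) C i

  paths-pascal : ∀ u i → paths (suc u) (suc i) ≡ paths u (suc i) + paths (suc u) i
  paths-pascal u i = begin
    suc (u + suc i) C suc i            ≡⟨ nCk+nC[k+1]≡[n+1]C[k+1] (u + suc i) i ⟨
    (u + suc i) C i + paths u (suc i)  ≡⟨ +-comm ((u + suc i) C i) _ ⟩
    paths u (suc i) + (u + suc i) C i  ≡⟨ cong (λ k → paths u (suc i) + k C i) (+-suc u i) ⟩
    paths u (suc i) + paths (suc u) i  ∎

  hockey-stick : ∀ u j → ∑< (suc j) (paths u) ≡ paths (suc u) j
  hockey-stick u zero    = refl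
  hockey-stick u (suc j) = begin
    ∑< (suc j) (paths u) + paths u (suc j)  ≡⟨ cong (_+ paths u (suc j)) (hockey-stick u j) ⟩
    paths (suc u) j + paths u (suc j)       ≡⟨ +-comm (paths (suc u) j) _ ⟩
    paths u (suc j) + paths (suc u) j       ≡⟨ paths-pascal u j ⟨
    paths (suc u) (suc j)                   ∎

  paths-absorb : ∀ d j → suc d * paths (suc d) j ≡ suc j * paths d (suc j)
  paths-absorb d       zero    = begin
    suc d * 1      ≡⟨ *-identityʳ (suc d) ⟩
    suc d          ≡⟨ +-comm 1 d ⟩
    d + 1          ≡⟨ nC1≡n (d + 1) ⟨
    paths d 1      ≡⟨ *-identityˡ (paths d 1) ⟨
    1 * paths d 1  ∎
  paths-absorb zero    (suc j) = begin
    1 * paths 1 (suc j)                  ≡⟨ *-identityˡ _ ⟩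
    paths 1 (suc j)                      ≡⟨ paths-pascal 0 j ⟩
    paths 0 (suc j) + paths 1 j          ≡⟨ cong₂ _+_ (nCn≡1 (suc j))
                                                         (trans (sym (*-identityˡ _)) (paths-absorb 0 j)) ⟩
    1 + suc j * paths 0 (suc j)          ≡⟨ cong (λ z → 1 + suc j * z) (nCn≡1 (suc j)) ⟩
    1 + suc j * 1                        ≡⟨ cong (suc (suc j) *_) (nCn≡1 (suc (suc j))) ⟨
    suc (suc j) * paths 0 (suc (suc j))  ∎
  paths-absorb (suc d) (suc j) = begin
    suc (suc d) * paths (suc (suc d)) (suc j)              ≡⟨ cong (suc (suc d) *_) (paths-pascal (suc d) j) ⟩
    suc (suc d) * (p + paths (suc (suc d)) j)              ≡⟨ *-distribˡ-+ (suc (suc d)) p _ ⟩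
    suc (suc d) * p + suc (suc d) * paths (suc (suc d)) j  ≡⟨ cong (suc (suc d) * p +_) (paths-absorb (suc d) j) ⟩
    suc (suc d) * p + suc j * p                            ≡⟨ regroup d j p ⟩
    suc d * p + suc (suc j) * p                            ≡⟨ cong (_+ suc (suc j) * p) (paths-absorb d (suc j)) ⟩
    suc (suc j) * q + suc (suc j) * p                      ≡⟨ *-distribˡ-+ (suc (suc j)) q p ⟨
    suc (suc j) * (q + p)                                  ≡⟨ cong (suc (suc j) *_) (paths-pascal d (suc j)) ⟨
    suc (suc j) * paths (suc d) (suc (suc j))              ∎
    where
    p = paths (suc d) (suc j)
    q = paths d (suc (suc j))
    regroup : ∀ d j p → suc (suc d) * p + suc j * p ≡ suc d * p + suc (suc j) * p
    regroup = solve-∀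

  C-ratio : ∀ N j → (N ∸ j) * (N C j) ≡ suc j * (N C suc j)
  C-ratio N j with j <? N
  ... | yes j<N with m≤n⇒∃[o]m+o≡n j<N
  ...   | d , refl = begin
    (suc j + d ∸ j) * ((suc j + d) C j)  ≡⟨ cong₂ _*_ (trans (cong (_∸ j) (sym (+-suc j d))) (m+n∸m≡n j (suc d)))
                                                      (cong (λ t → suc t C j) (+-comm j d)) ⟩
    suc d * paths (suc d) j              ≡⟨ paths-absorb d j ⟩
    suc j * paths d (suc j)              ≡⟨ cong (λ t → suc j * (t C suc j)) (+-comm d (suc j)) ⟩
    suc j * ((suc j + d) C suc j)        ∎
  C-ratio N j | no j≮N = begin
    (N ∸ j) * (N C j)    ≡⟨ cong (_* (N C j)) (m≤n⇒m∸n≡0 (≮⇒≥ j≮N)) ⟩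
    0                    ≡⟨ *-zeroʳ (suc j) ⟨
    suc j * 0            ≡⟨ cong (suc j *_) (k>n⇒nCk≡0 (s≤s (≮⇒≥ j≮N))) ⟨
    suc j * (N C suc j)  ∎

  vandermonde : ∀ a b s → ∑< (suc s) (λ i → (a C i) * (b C (s ∸ i))) ≡ (a + b) C s
  vandermonde a zero    s = begin
    ∑< s f + f s     ≡⟨ cong₂ _+_ (∑<-≡0 s (λ i i<s → trans (cong (λ j → (a C i) * (0 C j)) (+-∸-assoc 1 i<s))
                                                            (*-zeroʳ (a C i))))
                                  (cong (λ j → (a C s) * (0 C j)) (n∸n≡0 s)) ⟩
    0 + (a C s) * 1  ≡⟨ *-identityʳ (a C s) ⟩
    a C s            ≡⟨ cong (_C s) (+-identityʳ a) ⟨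
    (a + 0) C s      ∎
    where
    f : ℕ → ℕ
    f i = (a C i) * (0 C (s ∸ i))
  vandermonde a (suc b) zero    = refl
  vandermonde a (suc b) (suc s) = begin
    ∑< (suc s) f + f (suc s)
      ≡⟨ cong₂ _+_ (trans (∑<-cong (suc s) pascal) (∑<-+ (suc s) g₁ g₂))
                   (cong (λ j → (a C suc s) * (suc b C j)) (n∸n≡0 s)) ⟩
    ∑< (suc s) g₁ + ∑< (suc s) g₂ + (a C suc s) * 1
      ≡⟨ +-assoc (∑< (suc s) g₁) _ _ ⟩
    ∑< (suc s) g₁ + (∑< (suc s) g₂ + (a C suc s) * 1)
      ≡⟨ cong (λ j → ∑< (suc s) g₁ + (∑< (suc s) g₂ + (a C suc s) * (b C j))) (n∸n≡0 s) ⟨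
    ∑< (suc s) g₁ + ∑< (suc (suc s)) g₂
      ≡⟨ cong₂ _+_ (vandermonde a b s) (vandermonde a b (suc s)) ⟩
    (a + b) C s + (a + b) C suc s
      ≡⟨ nCk+nC[k+1]≡[n+1]C[k+1] (a + b) s ⟩
    suc (a + b) C suc s
      ≡⟨ cong (_C suc s) (+-suc a b) ⟨
    (a + suc b) C suc s
      ∎
    where
    f g₁ g₂ : ℕ → ℕ
    f  i = (a C i) * (suc b C (suc s ∸ i))
    g₁ i = (a C i) * (b C (s ∸ i))
    g₂ i = (a C i) * (b C (suc s ∸ i))
    pascal : ∀ i → i < suc s → f i ≡ g₁ i + g₂ i
    pascal i i<1+s = begin
      (a C i) * (suc b C (suc s ∸ i))            ≡⟨ cong (λ j → (a C i) * (suc b C j)) s∸i ⟩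
      (a C i) * (suc b C suc (s ∸ i))            ≡⟨ cong ((a C i) *_) (nCk+nC[k+1]≡[n+1]C[k+1] b (s ∸ i)) ⟨
      (a C i) * (b C (s ∸ i) + b C suc (s ∸ i))  ≡⟨ *-distribˡ-+ (a C i) _ _ ⟩
      g₁ i + (a C i) * (b C suc (s ∸ i))         ≡⟨ cong (λ j → g₁ i + (a C i) * (b C j)) s∸i ⟨
      g₁ i + g₂ i                                ∎
      where
      s∸i : suc s ∸ i ≡ suc (s ∸ i)
      s∸i = +-∸-assoc 1 (≤-pred i<1+s)

  central-vanish : ∀ {m k} → m < k → (2 * m) C (m + k) ≡ 0
  central-vanish {m} {k} m<k =
    k>n⇒nCk≡0 (subst (_< m + k) (cong (m +_) (sym (+-identityʳ m))) (+-monoʳ-< m m<k))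

  central-top : ∀ m → (2 * m) C (m + m) ≡ 1
  central-top m = trans (cong (λ t → (m + t) C (m + m)) (+-identityʳ m)) (nCn≡1 (m + m))

  central-reflect : ∀ {m} k → k ≤ m → (2 * m) C (m ∸ k) ≡ (2 * m) C (m + k)
  central-reflect k k≤m with m≤n⇒∃[o]m+o≡n k≤m
  ... | d , refl = trans (cong ((2 * (k + d)) C_) (m+n∸m≡n k d)) (C-sym d (k + d + k) (sum k d))
    where
    sum : ∀ k d → d + (k + d + k) ≡ 2 * (k + d)
    sum = solve-∀

  central-ratio : ∀ m k → (m ∸ k) * ((2 * m) C (m + k)) ≡ (m + suc k) * ((2 * m) C (m + suc k))
  central-ratio m k = begin
    (m ∸ k) * ((2 * m) C (m + k))            ≡⟨ cong (_* ((2 * m) C (m + k))) gap ⟨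
    (2 * m ∸ (m + k)) * ((2 * m) C (m + k))  ≡⟨ C-ratio (2 * m) (m + k) ⟩
    suc (m + k) * ((2 * m) C suc (m + k))    ≡⟨ cong (λ j → j * ((2 * m) C j)) (+-suc m k) ⟨
    (m + suc k) * ((2 * m) C (m + suc k))    ∎
    where
    gap : 2 * m ∸ (m + k) ≡ m ∸ k
    gap = trans (cong (λ t → m + t ∸ (m + k)) (+-identityʳ m)) ([m+n]∸[m+o]≡n∸o m m k)

  -- Hooks of the grid F

  rect : (ℕ → ℕ → ℕ) → ℕ → ℕ → ℕ
  rect f X Y = ∑< X (λ i → ∑< Y (f i))

  hook : (ℕ → ℕ → ℕ) → ℕ → ℕ → ℕ
  hook f X Y = ∑< Y (f X) + ∑< X (λ i → f i Y) + f X Y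

  rect-zeroʳ : ∀ f X → rect f X 0 ≡ 0
  rect-zeroʳ f X = ∑<-≡0 X (λ _ _ → refl)

  rect-step : ∀ f X Y → rect f (suc X) (suc Y) ≡ rect f X Y + hook f X Y
  rect-step f X Y = begin
    ∑< X (λ i → ∑< Y (f i) + f i Y) + ∑< (suc Y) (f X)
      ≡⟨ cong (_+ ∑< (suc Y) (f X)) (∑<-+ X (λ i → ∑< Y (f i)) (λ i → f i Y)) ⟩
    rect f X Y + ∑< X (λ i → f i Y) + (∑< Y (f X) + f X Y)
      ≡⟨ regroup (rect f X Y) (∑< X (λ i → f i Y)) (∑< Y (f X)) (f X Y) ⟩
    rect f X Y + hook f X Y
      ∎
    where
    regroup : ∀ a b c d → a + b + (c + d) ≡ a + (c + b + d)
    regroup = solve-∀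

  -- With T = m + n − 1, F T i j is the summand of the theorem at a = m − r − i, b = n − r − j.
  F : ℕ → ℕ → ℕ → ℕ
  F T i j = paths (T ∸ j) i * paths (T ∸ i) j

  ΔF : ℕ → ℕ → ℕ → ℕ
  ΔF T i j = paths (T ∸ suc j) i * paths (suc (T ∸ i)) j

  F-sym : ∀ T i j → F T i j ≡ F T j i
  F-sym T i j = *-comm (paths (T ∸ j) i) (paths (T ∸ i) j)

  F-eval : ∀ {T p q} i j → j + p ≡ T → i + q ≡ T → F T i j ≡ paths p i * paths q j
  F-eval i j e₁ e₂ = cong₂ (λ a b → paths a i * paths b j) (+⇒∸ e₁) (+⇒∸ e₂)

  ΔF-eval : ∀ {T p q} i j → suc j + p ≡ T → i + q ≡ T → ΔF T i j ≡ paths p i * paths (suc q) j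
  ΔF-eval i j e₁ e₂ = cong₂ (λ a b → paths a i * paths (suc b) j) (+⇒∸ e₁) (+⇒∸ e₂)

  row-cell : ∀ T i J → suc i ≤ T → suc (suc J) ≤ T →
             ΔF T (suc i) J + F T (suc i) (suc J) ≡ F T i (suc J) + ΔF T (suc i) (suc J)
  row-cell T i J 1+i≤T 2+J≤T = begin
    ΔF T (suc i) J + F T (suc i) (suc J)
      ≡⟨ cong₂ _+_ (ΔF-eval (suc i) J eP′ eQ) (F-eval (suc i) (suc J) eP′ eQ) ⟩
    a * paths (suc q) J + a * paths q (suc J)
      ≡⟨ *-distribˡ-+ a (paths (suc q) J) (paths q (suc J)) ⟨
    a * (paths (suc q) J + paths q (suc J))
      ≡⟨ cong (a *_) (trans (+-comm (paths (suc q) J) _) (sym (paths-pascal q J))) ⟩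
    a * b
      ≡⟨ cong (_* b) (trans (paths-pascal p i) (+-comm (paths p (suc i)) _)) ⟩
    (paths (suc p) i + paths p (suc i)) * b
      ≡⟨ *-distribʳ-+ b (paths (suc p) i) (paths p (suc i)) ⟩
    paths (suc p) i * b + paths p (suc i) * b
      ≡⟨ cong₂ _+_ (F-eval i (suc J) eP′ (trans (+-suc i q) eQ)) (ΔF-eval (suc i) (suc J) eP eQ) ⟨
    F T i (suc J) + ΔF T (suc i) (suc J)
      ∎
    where
    p = T ∸ suc (suc J)
    q = T ∸ suc i
    a = paths (suc p) (suc i)
    b = paths (suc q) (suc J)
    eP : suc (suc J) + p ≡ T
    eP = m+[n∸m]≡n 2+J≤T
    eP′ : suc J + suc p ≡ T
    eP′ = trans (+-suc (suc J) p) eP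
    eQ : suc i + q ≡ T
    eQ = m+[n∸m]≡n 1+i≤T

  row-step : ∀ T i J → suc i ≤ T → suc J ≤ T → ∑< (suc J) (F T (suc i)) ≡ ∑< (suc J) (F T i) + ΔF T (suc i) J
  row-step (suc T) i zero    _     _     = begin
    paths (suc T) (suc i) * 1                  ≡⟨ *-identityʳ _ ⟩
    paths (suc T) (suc i)                      ≡⟨ paths-pascal T i ⟩
    paths T (suc i) + paths (suc T) i          ≡⟨ +-comm (paths T (suc i)) _ ⟩
    paths (suc T) i + paths T (suc i)          ≡⟨ cong₂ _+_ (*-identityʳ (paths (suc T) i))
                                                               (*-identityʳ (paths T (suc i))) ⟨
    paths (suc T) i * 1 + paths T (suc i) * 1  ∎
  row-step T       i (suc J) 1+i≤T 2+J≤T = begin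
    ∑< (suc J) (F T (suc i)) + F T (suc i) (suc J)
      ≡⟨ cong (_+ F T (suc i) (suc J)) (row-step T i J 1+i≤T (<⇒≤ 2+J≤T)) ⟩
    ∑< (suc J) (F T i) + ΔF T (suc i) J + F T (suc i) (suc J)
      ≡⟨ +-assoc (∑< (suc J) (F T i)) _ _ ⟩
    ∑< (suc J) (F T i) + (ΔF T (suc i) J + F T (suc i) (suc J))
      ≡⟨ cong (∑< (suc J) (F T i) +_) (row-cell T i J 1+i≤T 2+J≤T) ⟩
    ∑< (suc J) (F T i) + (F T i (suc J) + ΔF T (suc i) (suc J))
      ≡⟨ +-assoc (∑< (suc J) (F T i)) _ _ ⟨
    ∑< (suc (suc J)) (F T i) + ΔF T (suc i) (suc J)
      ∎

  hook-step : ∀ T X Y p q → suc Y + p ≡ T → suc X + q ≡ T →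
              hook (F T) (suc X) (suc Y) ≡ hook (F T) X Y + paths (suc p) (suc X) * paths (suc q) (suc Y)
  hook-step T X Y p q eP eQ = begin
    ∑< (suc Y) (F T (suc X)) + ∑< (suc X) (λ i → F T i (suc Y)) + F T (suc X) (suc Y)
      ≡⟨ cong₂ (λ r c → r + c + F T (suc X) (suc Y)) (row-step T X Y 1+X≤T 1+Y≤T) column ⟩
    (∑< Y (F T X) + F T X Y + ΔF T (suc X) Y) + (∑< X (λ i → F T i Y) + F T Y X + ΔF T (suc Y) X)
      + F T (suc X) (suc Y)
      ≡⟨ regroup (∑< Y (F T X)) (F T X Y) (ΔF T (suc X) Y) (∑< X (λ i → F T i Y)) (F T Y X) (ΔF T (suc Y) X) _ ⟩
    hook (F T) X Y + (F T Y X + ΔF T (suc X) Y + ΔF T (suc Y) X + F T (suc X) (suc Y))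
      ≡⟨ cong (hook (F T) X Y +_) corner ⟩
    hook (F T) X Y + paths (suc p) (suc X) * paths (suc q) (suc Y)
      ∎
    where
    1+X≤T : suc X ≤ T
    1+X≤T = subst (suc X ≤_) eQ (m≤m+n (suc X) q)
    1+Y≤T : suc Y ≤ T
    1+Y≤T = subst (suc Y ≤_) eP (m≤m+n (suc Y) p)
    column : ∑< (suc X) (λ i → F T i (suc Y)) ≡ ∑< X (λ i → F T i Y) + F T Y X + ΔF T (suc Y) X
    column = begin
      ∑< (suc X) (λ i → F T i (suc Y))                  ≡⟨ ∑<-cong (suc X) (λ i _ → F-sym T i (suc Y)) ⟩
      ∑< (suc X) (F T (suc Y))                          ≡⟨ row-step T Y X 1+Y≤T 1+X≤T ⟩
      ∑< X (F T Y) + F T Y X + ΔF T (suc Y) X           ≡⟨ cong (λ s → s + F T Y X + ΔF T (suc Y) X)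
                                                              (∑<-cong X (λ i _ → F-sym T Y i)) ⟩
      ∑< X (λ i → F T i Y) + F T Y X + ΔF T (suc Y) X   ∎
    regroup : ∀ r₁ f₁ g₁ r₂ f₂ g₂ c →
              r₁ + f₁ + g₁ + (r₂ + f₂ + g₂) + c ≡ r₁ + r₂ + f₁ + (f₂ + g₁ + g₂ + c)
    regroup = solve-∀
    factor : ∀ a a′ b b′ → b * a + a′ * b + b′ * a + a′ * b′ ≡ (a′ + a) * (b′ + b)
    factor = solve-∀
    eP′ : Y + suc p ≡ T
    eP′ = trans (+-suc Y p) eP
    eQ′ : X + suc q ≡ T
    eQ′ = trans (+-suc X q) eQ
    corner : F T Y X + ΔF T (suc X) Y + ΔF T (suc Y) X + F T (suc X) (suc Y)
             ≡ paths (suc p) (suc X) * paths (suc q) (suc Y)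
    corner = begin
      F T Y X + ΔF T (suc X) Y + ΔF T (suc Y) X + F T (suc X) (suc Y)
        ≡⟨ cong₂ _+_ (cong₂ _+_ (cong₂ _+_ (F-eval Y X eQ′ eP′) (ΔF-eval (suc X) Y eP eQ))
                                (ΔF-eval (suc Y) X eQ eP))
                     (F-eval (suc X) (suc Y) eP eQ) ⟩
      paths (suc q) Y * paths (suc p) X + paths p (suc X) * paths (suc q) Y
        + paths q (suc Y) * paths (suc p) X + paths p (suc X) * paths q (suc Y)
        ≡⟨ factor (paths (suc p) X) (paths p (suc X)) (paths (suc q) Y) (paths q (suc Y)) ⟩
      (paths p (suc X) + paths (suc p) X) * (paths q (suc Y) + paths (suc q) Y)
        ≡⟨ cong₂ _*_ (paths-pascal p X) (paths-pascal q Y) ⟨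
      paths (suc p) (suc X) * paths (suc q) (suc Y)
        ∎

  hook-left-edge : ∀ T Y → hook (F T) 0 Y ≡ paths (suc T) Y
  hook-left-edge T Y = begin
    ∑< Y (F T 0) + 0 + F T 0 Y  ≡⟨ cong (_+ F T 0 Y) (+-identityʳ (∑< Y (F T 0))) ⟩
    ∑< (suc Y) (F T 0)          ≡⟨ ∑<-cong (suc Y) (λ j _ → *-identityˡ (paths T j)) ⟩
    ∑< (suc Y) (paths T)        ≡⟨ hockey-stick T Y ⟩
    paths (suc T) Y             ∎

  hook-top-edge : ∀ T X → hook (F T) X 0 ≡ paths (suc T) X
  hook-top-edge T X = begin
    ∑< (suc X) (λ i → F T i 0)  ≡⟨ ∑<-cong (suc X) (λ i _ → *-identityʳ (paths T i)) ⟩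
    ∑< (suc X) (paths T)        ≡⟨ hockey-stick T X ⟩
    paths (suc T) X             ∎

  -- Tails of the products P m n k

  P : ℕ → ℕ → ℕ → ℕ
  P m n k = ((2 * m) C (m + k)) * ((2 * n) C (n + k))

  P-zero : ∀ m n → P m n 0 ≡ ((2 * m) C m) * ((2 * n) C n)
  P-zero m n = cong₂ (λ i j → ((2 * m) C i) * ((2 * n) C j)) (+-identityʳ m) (+-identityʳ n)

  P-vanish : ∀ {m n k} → m ⊓ n < k → P m n k ≡ 0
  P-vanish {m} {n} {k} m⊓n<k with ⊓-sel m n
  ... | inj₁ m⊓n≡m = cong (_* ((2 * n) C (n + k))) (central-vanish (subst (_< k) m⊓n≡m m⊓n<k))
  ... | inj₂ m⊓n≡n = trans (cong (((2 * m) C (m + k)) *_) (central-vanish (subst (_< k) m⊓n≡n m⊓n<k)))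
                           (*-zeroʳ ((2 * m) C (m + k)))

  P-beyondˡ : ∀ m n k → m ≤ k → P m n (suc k) ≡ 0
  P-beyondˡ m n k m≤k = P-vanish (s≤s (≤-trans (m⊓n≤m m n) m≤k))

  P-beyondʳ : ∀ m n k → n ≤ k → P m n (suc k) ≡ 0
  P-beyondʳ m n k n≤k = P-vanish (s≤s (≤-trans (m⊓n≤n m n) n≤k))

  -- V m n r = Σ_{k>r} P m n k and W m n r = Σ_{k>r} (k − r) P m n k: as P m n k = 0 for k > m,
  -- m terms suffice.
  V : ℕ → ℕ → ℕ → ℕ
  V m n r = ∑< m (λ t → P m n (suc r + t))

  W : ℕ → ℕ → ℕ → ℕ
  W m n r = ∑< m (λ t → suc t * P m n (suc r + t))

  V-vanish : ∀ m n r → m ⊓ n ≤ r → V m n r ≡ 0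
  V-vanish m n r m⊓n≤r = ∑<-≡0 m (λ t _ → P-vanish (s≤s (≤-trans m⊓n≤r (m≤m+n r t))))

  W-vanish : ∀ m n r → m ⊓ n ≤ r → W m n r ≡ 0
  W-vanish m n r m⊓n≤r =
    ∑<-≡0 m (λ t _ → trans (cong (suc t *_) (P-vanish (s≤s (≤-trans m⊓n≤r (m≤m+n r t))))) (*-zeroʳ (suc t)))

  V-step : ∀ m n r → V m n r ≡ P m n (suc r) + V m n (suc r)
  V-step m n r = begin
    ∑< m (λ t → P m n (suc r + t))
      ≡⟨ ∑<-shift m _ (P-beyondˡ m n (r + m) (m≤n+m m r)) ⟩
    P m n (suc (r + 0)) + ∑< m (λ t → P m n (suc (r + suc t)))
      ≡⟨ cong₂ _+_ (cong (P m n ∘ suc) (+-identityʳ r)) (∑<-cong m (λ t _ → cong (P m n ∘ suc) (+-suc r t))) ⟩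
    P m n (suc r) + V m n (suc r)
      ∎

  V-last : ∀ m n r → m ⊓ n ≤ suc r → V m n r ≡ P m n (suc r)
  V-last m n r m⊓n≤1+r =
    trans (V-step m n r) (trans (cong (P m n (suc r) +_) (V-vanish m n (suc r) m⊓n≤1+r)) (+-identityʳ _))

  W-step : ∀ m n r → W m n r ≡ V m n r + W m n (suc r)
  W-step m n r = begin
    ∑< m (λ t → suc t * P m n (suc r + t))
      ≡⟨ ∑<-+ m (λ t → P m n (suc r + t)) (λ t → t * P m n (suc r + t)) ⟩
    V m n r + ∑< m (λ t → t * P m n (suc r + t))
      ≡⟨ cong (V m n r +_) (∑<-shift m _ (trans (cong (m *_) (P-beyondˡ m n (r + m) (m≤n+m m r))) (*-zeroʳ m))) ⟩
    V m n r + ∑< m (λ t → suc t * P m n (suc (r + suc t)))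
      ≡⟨ cong (V m n r +_) (∑<-cong m (λ t _ → cong (λ k → suc t * P m n (suc k)) (+-suc r t))) ⟩
    V m n r + W m n (suc r)
      ∎

  paths-as-central : ∀ {n} Y r → Y + suc r ≡ n → paths (suc (n + r)) Y ≡ (2 * n) C (n + suc r)
  paths-as-central Y r refl = trans (cong (_C Y) (top Y r)) (C-sym Y (Y + suc r + suc r) (sum Y r))
    where
    top : ∀ Y r → suc (Y + suc r + r) + Y ≡ 2 * (Y + suc r)
    top = solve-∀
    sum : ∀ Y r → Y + (Y + suc r + suc r) ≡ 2 * (Y + suc r)
    sum = solve-∀

  hook-closed : ∀ {m n} X Y r → X + suc r ≡ m → Y + suc r ≡ n → hook (F (pred m + n)) X Y ≡ V m n r
  hook-closed {m} {n} zero Y r refl refl = begin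
    hook (F (r + n)) 0 Y         ≡⟨ hook-left-edge (r + n) Y ⟩
    paths (suc (r + n)) Y        ≡⟨ cong (λ u → paths (suc u) Y) (+-comm r n) ⟩
    paths (suc (n + r)) Y        ≡⟨ paths-as-central Y r refl ⟩
    (2 * n) C (n + suc r)        ≡⟨ *-identityˡ _ ⟨
    1 * ((2 * n) C (n + suc r))  ≡⟨ cong (_* ((2 * n) C (n + suc r))) (central-top m) ⟨
    P m n (suc r)                ≡⟨ V-last m n r (m⊓n≤m m n) ⟨
    V m n r                      ∎
  hook-closed {m} {n} (suc X) zero r refl refl = begin
    hook (F T) (suc X) 0         ≡⟨ hook-top-edge T (suc X) ⟩
    paths (suc T) (suc X)        ≡⟨ cong (λ u → paths (suc u) (suc X)) (top X r) ⟩
    paths (suc (m + r)) (suc X)  ≡⟨ paths-as-central (suc X) r refl ⟩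
    (2 * m) C (m + suc r)        ≡⟨ *-identityʳ _ ⟨
    ((2 * m) C (m + suc r)) * 1  ≡⟨ cong (((2 * m) C (m + suc r)) *_) (central-top n) ⟨
    P m n (suc r)                ≡⟨ V-last m n r (m⊓n≤n m n) ⟨
    V m n r                      ∎
    where
    T = pred m + n
    top : ∀ X r → X + suc r + suc r ≡ suc X + suc r + r
    top = solve-∀
  hook-closed {m} {n} (suc X) (suc Y) r refl refl = begin
    hook (F T) (suc X) (suc Y)
      ≡⟨ hook-step T X Y (m + r) (n + r) (eP X Y r) (eQ X Y r) ⟩
    hook (F T) X Y + paths (suc (m + r)) (suc X) * paths (suc (n + r)) (suc Y)
      ≡⟨ cong₂ _+_ (hook-closed X Y (suc r) (+-suc X (suc r)) (+-suc Y (suc r)))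
                   (cong₂ _*_ (paths-as-central (suc X) r refl) (paths-as-central (suc Y) r refl)) ⟩
    V m n (suc r) + P m n (suc r)
      ≡⟨ +-comm (V m n (suc r)) _ ⟩
    P m n (suc r) + V m n (suc r)
      ≡⟨ V-step m n r ⟨
    V m n r
      ∎
    where
    T = pred m + n
    eP : ∀ X Y r → suc Y + (suc X + suc r + r) ≡ X + suc r + (suc Y + suc r)
    eP = solve-∀
    eQ : ∀ X Y r → suc X + (suc Y + suc r + r) ≡ X + suc r + (suc Y + suc r)
    eQ = solve-∀

  rect-closed : ∀ {m n} X Y r → X + r ≡ m → Y + r ≡ n → rect (F (pred m + n)) X Y ≡ W m n r
  rect-closed {m} {n} zero    Y       r refl refl = sym (W-vanish m n r (m⊓n≤m m n))
  rect-closed {m} {n} (suc X) zero    r refl refl =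
    trans (rect-zeroʳ (F (pred m + n)) (suc X)) (sym (W-vanish m n r (m⊓n≤n m n)))
  rect-closed {m} {n} (suc X) (suc Y) r refl refl = begin
    rect (F T) (suc X) (suc Y)       ≡⟨ rect-step (F T) X Y ⟩
    rect (F T) X Y + hook (F T) X Y  ≡⟨ cong₂ _+_ (rect-closed X Y (suc r) (+-suc X r) (+-suc Y r))
                                                  (hook-closed X Y r (+-suc X r) (+-suc Y r)) ⟩
    W m n (suc r) + V m n r          ≡⟨ +-comm (W m n (suc r)) _ ⟩
    V m n r + W m n (suc r)          ≡⟨ W-step m n r ⟨
    W m n r                          ∎
    where
    T = pred m + n

  rect-tail : ∀ m n r → rect (F (pred m + n)) (m ∸ r) (n ∸ r) ≡ W m n r
  rect-tail m n r with r ≤? m | r ≤? n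
  ... | yes r≤m | yes r≤n = rect-closed (m ∸ r) (n ∸ r) r (m∸n+n≡m r≤m) (m∸n+n≡m r≤n)
  ... | no r≰m  | _       = begin
    rect (F (pred m + n)) (m ∸ r) (n ∸ r)  ≡⟨ cong (λ X → rect (F (pred m + n)) X (n ∸ r)) (m≤n⇒m∸n≡0 m≤r) ⟩
    0                                      ≡⟨ W-vanish m n r (≤-trans (m⊓n≤m m n) m≤r) ⟨
    W m n r                                ∎
    where
    m≤r = <⇒≤ (≰⇒> r≰m)
  ... | yes _   | no r≰n  = begin
    rect (F (pred m + n)) (m ∸ r) (n ∸ r)  ≡⟨ cong (rect (F (pred m + n)) (m ∸ r)) (m≤n⇒m∸n≡0 n≤r) ⟩
    rect (F (pred m + n)) (m ∸ r) 0        ≡⟨ rect-zeroʳ (F (pred m + n)) (m ∸ r) ⟩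
    0                                      ≡⟨ W-vanish m n r (≤-trans (m⊓n≤n m n) n≤r) ⟨
    W m n r                                ∎
    where
    n≤r = <⇒≤ (≰⇒> r≰n)

  -- The three identities for P

  E : ℕ → ℕ → ℕ → ℕ
  E m n k = (m ∸ k) * (n ∸ k) * P m n k

  E-vanish : ∀ {m n k} → m ⊓ n ≤ k → E m n k ≡ 0
  E-vanish {m} {n} {k} m⊓n≤k with ⊓-sel m n
  ... | inj₁ m⊓n≡m = cong (λ d → d * (n ∸ k) * P m n k) (m≤n⇒m∸n≡0 (subst (_≤ k) m⊓n≡m m⊓n≤k))
  ... | inj₂ m⊓n≡n = cong (λ d → d * P m n k)
                          (trans (cong ((m ∸ k) *_) (m≤n⇒m∸n≡0 (subst (_≤ k) m⊓n≡n m⊓n≤k))) (*-zeroʳ (m ∸ k)))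

  -- By central-ratio, E m n k = (m + k + 1)(n + k + 1) P m n (k + 1), and
  -- (m + k + 1)(n + k + 1) − (m − k − 1)(n − k − 1) = 2(m + n)(k + 1).
  E-step : ∀ m n k → 2 * (m + n) * (suc k * P m n (suc k)) + E m n (suc k) ≡ E m n k
  E-step m n k with m ⊓ n ≤? k
  ... | yes m⊓n≤k = begin
    2 * (m + n) * (suc k * P m n (suc k)) + E m n (suc k)
      ≡⟨ cong₂ (λ p e → 2 * (m + n) * (suc k * p) + e)
               (P-vanish (s≤s m⊓n≤k)) (E-vanish (m≤n⇒m≤1+n m⊓n≤k)) ⟩
    2 * (m + n) * (suc k * 0) + 0
      ≡⟨ cong (_+ 0) (trans (cong (2 * (m + n) *_) (*-zeroʳ (suc k))) (*-zeroʳ (2 * (m + n)))) ⟩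
    0
      ≡⟨ E-vanish m⊓n≤k ⟨
    E m n k
      ∎
  ... | no m⊓n≰k with m≤n⇒∃[o]m+o≡n (<-≤-trans (≰⇒> m⊓n≰k) (m⊓n≤m m n))
                    | m≤n⇒∃[o]m+o≡n (<-≤-trans (≰⇒> m⊓n≰k) (m⊓n≤n m n))
  ...   | a , refl | b , refl = begin
    2 * (m + n) * (suc k * (x′ * y′)) + (m ∸ suc k) * (n ∸ suc k) * (x′ * y′)
      ≡⟨ cong₂ (λ u v → 2 * (m + n) * (suc k * (x′ * y′)) + u * v * (x′ * y′))
               (m+n∸m≡n (suc k) a) (m+n∸m≡n (suc k) b) ⟩
    2 * (m + n) * (suc k * (x′ * y′)) + a * b * (x′ * y′)
      ≡⟨ polynomial k a b x′ y′ ⟩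
    (m + suc k) * x′ * ((n + suc k) * y′)
      ≡⟨ cong₂ _*_ (central-ratio m k) (central-ratio n k) ⟨
    (m ∸ k) * x * ((n ∸ k) * y)
      ≡⟨ regroup (m ∸ k) (n ∸ k) x y ⟩
    E m n k
      ∎
    where
    x = (2 * m) C (m + k)
    y = (2 * n) C (n + k)
    x′ = (2 * m) C (m + suc k)
    y′ = (2 * n) C (n + suc k)
    polynomial : ∀ k a b x y → 2 * ((suc k + a) + (suc k + b)) * (suc k * (x * y)) + a * b * (x * y)
                             ≡ (suc k + a + suc k) * x * ((suc k + b + suc k) * y)
    polynomial = solve-∀
    regroup : ∀ u v x y → u * x * (v * y) ≡ u * v * (x * y)
    regroup = solve-∀

  first-moment : ∀ m n → 2 * (m + n) * W m n 0 ≡ m * n * (((2 * m) C m) * ((2 * n) C n))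
  first-moment m n = begin
    2 * (m + n) * W m n 0                    ≡⟨ *-distribˡ-∑< (2 * (m + n)) m _ ⟩
    ∑< m step                                ≡⟨ +-identityʳ _ ⟨
    ∑< m step + 0                            ≡⟨ cong (∑< m step +_) (E-vanish (m⊓n≤m m n)) ⟨
    ∑< m step + E m n m                      ≡⟨ ∑<-telescope step (E m n) (E-step m n) m ⟩
    m * n * P m n 0                          ≡⟨ cong (m * n *_) (P-zero m n) ⟩
    m * n * (((2 * m) C m) * ((2 * n) C n))  ∎
    where
    step : ℕ → ℕ
    step k = 2 * (m + n) * (suc k * P m n (suc k))

  V-bound-n : ∀ m n → ∑< n (λ t → P m n (suc t)) ≡ V m n 0
  V-bound-n m n = begin
    ∑< n (P m n ∘ suc)        ≡⟨ ∑<-extend (P m n ∘ suc) (m≤n+m n m) (P-beyondʳ m n) ⟨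
    ∑< (m + n) (P m n ∘ suc)  ≡⟨ ∑<-extend (P m n ∘ suc) (m≤m+n m n) (P-beyondˡ m n) ⟩
    V m n 0                   ∎

  central-vandermonde : ∀ m n → (2 * m + 2 * n) C (m + n) ≡ ((2 * m) C m) * ((2 * n) C n) + 2 * V m n 0
  central-vandermonde m n = begin
    (2 * m + 2 * n) C (m + n)                          ≡⟨ vandermonde (2 * m) (2 * n) (m + n) ⟨
    ∑< (suc (m + n)) f                                 ≡⟨ cong (λ k → ∑< k f) (+-suc m n) ⟨
    ∑< (m + suc n) f                                   ≡⟨ ∑<-split m (suc n) f ⟩
    ∑< m f + ∑< (suc n) (λ i → f (m + i))              ≡⟨ cong (∑< m f +_) (∑<-uncons n (λ i → f (m + i))) ⟩
    ∑< m f + (f (m + 0) + ∑< n (λ i → f (m + suc i)))  ≡⟨ cong₂ _+_ lower (cong₂ _+_ middle upper) ⟩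
    V m n 0 + (c + V m n 0)                            ≡⟨ regroup (V m n 0) c ⟩
    c + 2 * V m n 0                                    ∎
    where
    c = ((2 * m) C m) * ((2 * n) C n)
    f : ℕ → ℕ
    f i = ((2 * m) C i) * ((2 * n) C (m + n ∸ i))
    regroup : ∀ v c → v + (c + v) ≡ c + 2 * v
    regroup = solve-∀
    complement : ∀ {x y} → x + y ≡ m → x + (n + y) ≡ m + n
    complement {x} {y} refl = shuffle x y n
      where
      shuffle : ∀ x y n → x + (n + y) ≡ x + y + n
      shuffle = solve-∀
    lower : ∑< m f ≡ V m n 0
    lower = trans (∑<-reverse m f) (∑<-cong m (λ t t<m →
      cong₂ _*_ (central-reflect (suc t) t<m)
                (cong ((2 * n) C_) (+⇒∸ {m + n} {m ∸ suc t} {n + suc t} (complement {m ∸ suc t} (m∸n+n≡m t<m))))))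
    middle : f (m + 0) ≡ c
    middle = cong₂ (λ i j → ((2 * m) C i) * ((2 * n) C j)) (+-identityʳ m) ([m+n]∸[m+o]≡n∸o m n 0)
    upper : ∑< n (λ i → f (m + suc i)) ≡ V m n 0
    upper = trans (∑<-cong n (λ i i<n → cong (((2 * m) C (m + suc i)) *_)
                    (trans (cong ((2 * n) C_) ([m+n]∸[m+o]≡n∸o m n (suc i))) (central-reflect (suc i) i<n))))
                  (V-bound-n m n)

  Z : ℕ → ℕ → ℕ → ℕ
  Z m n r = ∑< (r ∸ 1) (λ k → (r ∸ suc k) * P m n (suc k))

  weights : ∀ m n r → W m n r + r * V m n 0 ≡ W m n 0 + Z m n r
  weights m n r = begin
    W m n r + r * V m n 0                                      ≡⟨ cong₂ _+_ W-as V-as ⟨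
    ∑< K (λ k → (suc k ∸ r) * p k) + ∑< K (λ k → r * p k)      ≡⟨ ∑<-+ K _ _ ⟨
    ∑< K (λ k → (suc k ∸ r) * p k + r * p k)                   ≡⟨ ∑<-cong K (λ k _ → swap (suc k) (p k)) ⟩
    ∑< K (λ k → suc k * p k + (r ∸ suc k) * p k)               ≡⟨ ∑<-+ K _ _ ⟩
    ∑< K (λ k → suc k * p k) + ∑< K (λ k → (r ∸ suc k) * p k)  ≡⟨ cong₂ _+_ W₀-as Z-as ⟩
    W m n 0 + Z m n r                                          ∎
    where
    K = r + m
    p : ℕ → ℕ
    p k = P m n (suc k)
    swap : ∀ x y → (x ∸ r) * y + r * y ≡ x * y + (r ∸ x) * y
    swap x y = begin
      (x ∸ r) * y + r * y  ≡⟨ *-distribʳ-+ y (x ∸ r) r ⟨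
      ((x ∸ r) + r) * y    ≡⟨ cong (_* y) (∸-+-swap x r) ⟩
      (x + (r ∸ x)) * y    ≡⟨ *-distribʳ-+ y x (r ∸ x) ⟩
      x * y + (r ∸ x) * y  ∎
    W-as : ∑< K (λ k → (suc k ∸ r) * p k) ≡ W m n r
    W-as = begin
      ∑< K (λ k → (suc k ∸ r) * p k)
        ≡⟨ ∑<-split r m _ ⟩
      ∑< r (λ k → (suc k ∸ r) * p k) + ∑< m (λ t → (suc (r + t) ∸ r) * p (r + t))
        ≡⟨ cong₂ _+_ (∑<-≡0 r (λ k k<r → cong (_* p k) (m≤n⇒m∸n≡0 k<r)))
                     (∑<-cong m (λ t _ → cong (_* p (r + t)) (+⇒∸ (+-suc r t)))) ⟩
      W m n r
        ∎
    V-as : ∑< K (λ k → r * p k) ≡ r * V m n 0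
    V-as = trans (∑<-extend _ (m≤n+m m r) (λ k m≤k → trans (cong (r *_) (P-beyondˡ m n k m≤k)) (*-zeroʳ r)))
                 (sym (*-distribˡ-∑< r m p))
    W₀-as : ∑< K (λ k → suc k * p k) ≡ W m n 0
    W₀-as = ∑<-extend _ (m≤n+m m r) (λ k m≤k → trans (cong (suc k *_) (P-beyondˡ m n k m≤k)) (*-zeroʳ (suc k)))
    Z-as : ∑< K (λ k → (r ∸ suc k) * p k) ≡ Z m n r
    Z-as = ∑<-extend _ (≤-trans (m∸n≤m r 1) (m≤m+n r m))
                       (λ k r∸1≤k → cong (_* p k) (trans (sym (∸-+-assoc r 1 k)) (m≤n⇒m∸n≡0 r∸1≤k)))

  summand : ℕ → ℕ → ℕ → ℕ → ℕ → ℕ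
  summand m n r a b = ((((2 * m ∸ a) + b) ∸ 1) C ((m ∸ r) ∸ a)) * ((((2 * n + a) ∸ b) ∸ 1) C ((n ∸ r) ∸ b))

  summand-F : ∀ i a j b r →
              summand (suc i + a + r) (suc j + b + r) r (suc a) (suc b) ≡ F (i + a + r + (suc j + b + r)) i j
  summand-F i a j b r = begin
    summand m n r (suc a) (suc b)              ≡⟨ cong₂ _*_ (cong₂ _C_ top₁ low₁) (cong₂ _C_ top₂ low₂) ⟩
    paths (m + r + b) i * paths (n + r + a) j  ≡⟨ F-eval i j (e₅ i a j b r) (e₆ i a j b r) ⟨
    F (pred m + n) i j                         ∎
    where
    m = suc i + a + r
    n = suc j + b + r
    e₁ : ∀ i a r → suc a + (i + (suc i + a + r) + r) ≡ 2 * (suc i + a + r)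
    e₁ = solve-∀
    e₂ : ∀ i a r b → i + (suc i + a + r) + r + b ≡ suc i + a + r + r + b + i
    e₂ = solve-∀
    e₃ : ∀ j b r a → suc b + (j + (suc j + b + r) + r + suc a) ≡ 2 * (suc j + b + r) + suc a
    e₃ = solve-∀
    e₄ : ∀ j b r a → j + (suc j + b + r) + r + a ≡ suc j + b + r + r + a + j
    e₄ = solve-∀
    e₅ : ∀ i a j b r → j + (suc i + a + r + r + b) ≡ i + a + r + (suc j + b + r)
    e₅ = solve-∀
    e₆ : ∀ i a j b r → i + (suc j + b + r + r + a) ≡ i + a + r + (suc j + b + r)
    e₆ = solve-∀
    top₁ : ((2 * m ∸ suc a) + suc b) ∸ 1 ≡ m + r + b + i
    top₁ = begin
      ((2 * m ∸ suc a) + suc b) ∸ 1  ≡⟨ cong (λ x → (x + suc b) ∸ 1) (+⇒∸ {2 * m} {suc a} {i + m + r} (e₁ i a r)) ⟩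
      (i + m + r + suc b) ∸ 1        ≡⟨ cong (_∸ 1) (+-suc (i + m + r) b) ⟩
      i + m + r + b                  ≡⟨ e₂ i a r b ⟩
      m + r + b + i                  ∎
    top₂ : ((2 * n + suc a) ∸ suc b) ∸ 1 ≡ n + r + a + j
    top₂ = begin
      ((2 * n + suc a) ∸ suc b) ∸ 1  ≡⟨ cong (_∸ 1) (+⇒∸ {2 * n + suc a} {suc b} {j + n + r + suc a} (e₃ j b r a)) ⟩
      (j + n + r + suc a) ∸ 1        ≡⟨ cong (_∸ 1) (+-suc (j + n + r) a) ⟩
      j + n + r + a                  ≡⟨ e₄ j b r a ⟩
      n + r + a + j                  ∎
    low₁ : (m ∸ r) ∸ suc a ≡ i
    low₁ = trans (cong (_∸ suc a) (m+n∸n≡m (suc i + a) r)) (m+n∸n≡m i a)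
    low₂ : (n ∸ r) ∸ suc b ≡ j
    low₂ = trans (cong (_∸ suc b) (m+n∸n≡m (suc j + b) r)) (m+n∸n≡m j b)

  summand-at : ∀ {m n} r i j a b → suc i + a + r ≡ m → suc j + b + r ≡ n →
               summand m n r (suc a) (suc b) ≡ F (pred m + n) i j
  summand-at r i j a b refl refl = summand-F i a j b r

  below-∸ : ∀ {m r i} → i < m ∸ r → suc i + (m ∸ r ∸ suc i) + r ≡ m
  below-∸ {m} {r} {i} i<m∸r = trans (cong (_+ r) (m+[n∸m]≡n i<m∸r)) (m∸n+n≡m (<⇒≤ r<m))
    where
    r<m : r < m
    r<m = m∸n≢0⇒n<m (λ m∸r≡0 → n≮0 (subst (i <_) m∸r≡0 i<m∸r))

  summand-rect : ∀ m n r → ∑< (m ∸ r) (λ i → ∑< (n ∸ r) (λ j → summand m n r (suc i) (suc j)))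
                           ≡ rect (F (pred m + n)) (m ∸ r) (n ∸ r)
  summand-rect m n r = begin
    ∑< M (λ i → ∑< N (λ j → summand m n r (suc i) (suc j)))
      ≡⟨ ∑<-reverse M _ ⟩
    ∑< M (λ i → ∑< N (λ j → summand m n r (suc (M ∸ suc i)) (suc j)))
      ≡⟨ ∑<-cong M (λ i i<M → trans (∑<-reverse N _) (∑<-cong N (λ j j<N →
           summand-at r i j (M ∸ suc i) (N ∸ suc j) (below-∸ i<M) (below-∸ j<N)))) ⟩
    rect (F (pred m + n)) M N
      ∎
    where
    M = m ∸ r
    N = n ∸ r

module Embedding where
  open import Data.Nat as ℕ using (ℕ; zero; suc)
  import Data.Nat.Properties as ℕ
  open import Data.Nat.Tactic.RingSolver using (solve-∀)
  open import Data.Nat.Combinatorics using (_C_)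
  open import Data.Integer as ℤ using (+_)
  import Data.Integer.Properties as ℤ
  open import Data.Rational using (ℚ; _/_; _+_; _-_; _*_; toℚᵘ)
  open import Data.Rational.Properties using (toℚᵘ-injective; toℚᵘ-fromℚᵘ; toℚᵘ-homo-+; toℚᵘ-homo-*)
  open import Data.Rational.Unnormalised as ℚᵘ using (mkℚᵘ; *≡*)
  import Data.Rational.Unnormalised.Properties as ℚᵘ
  open import Data.Rational.Solver using (module +-*-Solver)
  open import Relation.Binary.PropositionalEquality
  open import Relation.Nullary using (yes; no)
  open BinomialSums using (∑<; central-vanish; central-reflect; P; V; W; Z; weights; rect-tail; summand; summand-rect)

  ι : ℕ → ℚ
  ι x = + x / 1

  toℚᵘ-ι : ∀ x → toℚᵘ (ι x) ℚᵘ.≃ mkℚᵘ (+ x) 0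
  toℚᵘ-ι x = toℚᵘ-fromℚᵘ (mkℚᵘ (+ x) 0)

  ι-+ : ∀ x y → ι (x ℕ.+ y) ≡ ι x + ι y
  ι-+ x y = toℚᵘ-injective (begin-equality
    toℚᵘ (ι (x ℕ.+ y))               ≃⟨ toℚᵘ-ι (x ℕ.+ y) ⟩
    mkℚᵘ (+ (x ℕ.+ y)) 0            ≃⟨ *≡* sum ⟨
    mkℚᵘ (+ x) 0 ℚᵘ.+ mkℚᵘ (+ y) 0  ≃⟨ ℚᵘ.+-cong (toℚᵘ-ι x) (toℚᵘ-ι y) ⟨
    toℚᵘ (ι x) ℚᵘ.+ toℚᵘ (ι y)      ≃⟨ toℚᵘ-homo-+ (ι x) (ι y) ⟨
    toℚᵘ (ι x + ι y)                ∎)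
    where
    open ℚᵘ.≤-Reasoning
    sum : (+ x ℤ.* + 1 ℤ.+ + y ℤ.* + 1) ℤ.* + 1 ≡ + (x ℕ.+ y) ℤ.* + 1
    sum = trans (ℤ.*-identityʳ _) (trans (cong₂ ℤ._+_ (ℤ.*-identityʳ (+ x)) (ℤ.*-identityʳ (+ y)))
                                         (trans (sym (ℤ.pos-+ x y)) (sym (ℤ.*-identityʳ (+ (x ℕ.+ y))))))

  ι-fraction : ∀ a d b c → suc d ℕ.* c ≡ a ℕ.* b → (+ a / suc d) * ι b ≡ ι c
  ι-fraction a d b c eq = toℚᵘ-injective (begin-equality
    toℚᵘ (+ a / suc d * ι b)            ≃⟨ toℚᵘ-homo-* (+ a / suc d) (ι b) ⟩
    toℚᵘ (+ a / suc d) ℚᵘ.* toℚᵘ (ι b)  ≃⟨ ℚᵘ.*-cong (toℚᵘ-fromℚᵘ (mkℚᵘ (+ a) d)) (toℚᵘ-ι b) ⟩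
    mkℚᵘ (+ a) d ℚᵘ.* mkℚᵘ (+ b) 0      ≃⟨ *≡* cross ⟩
    mkℚᵘ (+ c) 0                        ≃⟨ toℚᵘ-ι c ⟨
    toℚᵘ (ι c)                          ∎)
    where
    open ℚᵘ.≤-Reasoning
    reorder : ∀ d c → suc d ℕ.* c ≡ c ℕ.* (suc d ℕ.* 1)
    reorder = solve-∀
    cross : (+ a ℤ.* + b) ℤ.* + 1 ≡ + c ℤ.* + (suc d ℕ.* 1)
    cross = trans (ℤ.*-identityʳ _) (trans (sym (ℤ.pos-* a b))
                  (trans (cong +_ (trans (sym eq) (reorder d c))) (ℤ.pos-* c (suc d ℕ.* 1))))

  sum1-cong : ∀ M {f g : ℕ → ℚ} → (∀ a → f a ≡ g a) → sum1 M f ≡ sum1 M g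
  sum1-cong zero    f≗g = refl
  sum1-cong (suc M) f≗g = cong₂ _+_ (sum1-cong M f≗g) (f≗g (suc M))

  sum1-ι : ∀ M (h : ℕ → ℕ) → sum1 M (λ a → ι (h a)) ≡ ι (∑< M (λ i → h (suc i)))
  sum1-ι zero    h = refl
  sum1-ι (suc M) h =
    trans (cong (_+ ι (h (suc M))) (sum1-ι M h)) (sym (ι-+ (∑< M (λ i → h (suc i))) (h (suc M))))

  binomℤ-negative : ∀ N x → 0 ℕ.< x → binomℤ N (ℤ.- + x) ≡ 0
  binomℤ-negative N (suc x) _ = refl

  binomℤ-central : ∀ m k → binomℤ (2 ℕ.* m) (+ m ℤ.- + k) ≡ (2 ℕ.* m) C (m ℕ.+ k)
  binomℤ-central m k with k ℕ.≤? m
  ... | yes k≤m =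
    trans (cong (binomℤ (2 ℕ.* m)) (trans (ℤ.[+m]-[+n]≡m⊖n m k) (ℤ.⊖-≥ k≤m))) (central-reflect k k≤m)
  ... | no k≰m  = begin
    binomℤ (2 ℕ.* m) (+ m ℤ.- + k)      ≡⟨ cong (binomℤ (2 ℕ.* m)) (trans (ℤ.[+m]-[+n]≡m⊖n m k) (ℤ.⊖-< m<k)) ⟩
    binomℤ (2 ℕ.* m) (ℤ.- + (k ℕ.∸ m))  ≡⟨ binomℤ-negative (2 ℕ.* m) (k ℕ.∸ m) (ℕ.m<n⇒0<n∸m m<k) ⟩
    0                                    ≡⟨ central-vanish m<k ⟨
    (2 ℕ.* m) C (m ℕ.+ k)                ∎
    where
    open ≡-Reasoning
    m<k = ℕ.≰⇒> k≰m

  sum1-summand : ∀ m n r → sum1 (m ℕ.∸ r) (λ a → sum1 (n ℕ.∸ r) (λ b → ι (summand m n r a b))) ≡ ι (W m n r)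
  sum1-summand m n r = begin
    sum1 (m ℕ.∸ r) (λ a → sum1 (n ℕ.∸ r) (λ b → ι (summand m n r a b)))
      ≡⟨ sum1-cong (m ℕ.∸ r) (λ a → sum1-ι (n ℕ.∸ r) (summand m n r a)) ⟩
    sum1 (m ℕ.∸ r) (λ a → ι (∑< (n ℕ.∸ r) (λ j → summand m n r a (suc j))))
      ≡⟨ sum1-ι (m ℕ.∸ r) (λ a → ∑< (n ℕ.∸ r) (λ j → summand m n r a (suc j))) ⟩
    ι (∑< (m ℕ.∸ r) (λ i → ∑< (n ℕ.∸ r) (λ j → summand m n r (suc i) (suc j))))
      ≡⟨ cong ι (trans (summand-rect m n r) (rect-tail m n r)) ⟩
    ι (W m n r)
      ∎
    where
    open ≡-Reasoning

  Zℚ : ℕ → ℕ → ℕ → ℚ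
  Zℚ m n r = sum1 (r ℕ.∸ 1) (λ k → ι ((r ℕ.∸ k) ℕ.* (binomℤ (2 ℕ.* m) (+ m ℤ.- + k) ℕ.* binomℤ (2 ℕ.* n) (+ n ℤ.- + k))))

  Zℚ≡Z : ∀ m n r → Zℚ m n r ≡ ι (Z m n r)
  Zℚ≡Z m n r = trans (sum1-cong (r ℕ.∸ 1) (λ k → cong (λ x → ι ((r ℕ.∸ k) ℕ.* x))
                                                      (cong₂ ℕ._*_ (binomℤ-central m k) (binomℤ-central n k))))
                     (sum1-ι (r ℕ.∸ 1) (λ k → (r ℕ.∸ k) ℕ.* P m n k))

  sum1-weights : ∀ m n r → ι (W m n r) + ι (r ℕ.* V m n 0) ≡ ι (W m n 0) + Zℚ m n r
  sum1-weights m n r = begin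
    ι (W m n r) + ι (r ℕ.* V m n 0)  ≡⟨ ι-+ (W m n r) (r ℕ.* V m n 0) ⟨
    ι (W m n r ℕ.+ r ℕ.* V m n 0)    ≡⟨ cong ι (weights m n r) ⟩
    ι (W m n 0 ℕ.+ Z m n r)          ≡⟨ ι-+ (W m n 0) (Z m n r) ⟩
    ι (W m n 0) + ι (Z m n r)        ≡⟨ cong (λ s → ι (W m n 0) + s) (Zℚ≡Z m n r) ⟨
    ι (W m n 0) + Zℚ m n r           ∎
    where
    open ≡-Reasoning

  rearrange : ∀ (c p h C v u t w z : ℚ) → c * p ≡ w → C ≡ p + v → h * v ≡ u → t + u ≡ w + z →
              ((c * p - h * C) + h * p) + z ≡ t
  rearrange c p h C v u t w z cp≡w C≡p+v hv≡u t+u≡w+z = begin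
    ((c * p - h * C) + h * p) + z    ≡⟨ cong₂ (λ a b → ((a - h * b) + h * p) + z) cp≡w C≡p+v ⟩
    ((w - h * (p + v)) + h * p) + z  ≡⟨ expand w h p v z ⟩
    (w + z) - h * v                  ≡⟨ cong₂ _-_ (sym t+u≡w+z) hv≡u ⟩
    (t + u) - u                      ≡⟨ cancel t u ⟩
    t                                ∎
    where
    open ≡-Reasoning
    open +-*-Solver
    expand : ∀ w h p v z → ((w - h * (p + v)) + h * p) + z ≡ (w + z) - h * v
    expand = solve 5 (λ w h p v z → ((w :- h :* (p :+ v)) :+ h :* p) :+ z := (w :+ z) :- h :* v) refl
    cancel : ∀ t u → (t + u) - u ≡ t
    cancel = solve 2 (λ t u → (t :+ u) :- u := t) refl

open import Data.Nat using (ℕ; _≤_; _∸_) renaming (_+_ to _+ℕ_; _*_ to _*ℕ_)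
open import Data.Nat.Combinatorics using (_C_)
open import Data.Integer using (+_) renaming (_-_ to _⊖_)
open import Data.Rational using (ℚ; _/_; _+_; _-_; _*_)
open import Relation.Binary.PropositionalEquality using (_≡_)

open import Data.Nat using (suc; s≤s; z≤n)
open import Data.Nat.Tactic.RingSolver using (solve-∀)
open import Relation.Binary.PropositionalEquality using (sym; trans; cong)
open BinomialSums using (V; W; first-moment; central-vandermonde)
open Embedding

mainTheorem7 : (m n r : ℕ) → (hm : 1 ≤ m) → 1 ≤ n → 1 ≤ r →
    sum1 (m ∸ r) (λ a → sum1 (n ∸ r) (λ b →
      (+ (((((2 *ℕ m ∸ a) +ℕ b) ∸ 1) C ((m ∸ r) ∸ a)) *ℕ ((((2 *ℕ n +ℕ a) ∸ b) ∸ 1) C ((n ∸ r) ∸ b)))) / 1))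
    ≡ ((((_/_ (+ (m *ℕ n)) (2 *ℕ (m +ℕ n)) {{nz2mn m n hm}}) * ((+ (((2 *ℕ m) C m) *ℕ ((2 *ℕ n) C n))) / 1))
       - (((+ r) / 2) * ((+ ((2 *ℕ m +ℕ 2 *ℕ n) C (m +ℕ n))) / 1)))
       + (((+ r) / 2) * ((+ (((2 *ℕ m) C m) *ℕ ((2 *ℕ n) C n))) / 1)))
       + sum1 (r ∸ 1) (λ k → (+ ((r ∸ k) *ℕ ((binomℤ (2 *ℕ m) (+ m ⊖ + k)) *ℕ (binomℤ (2 *ℕ n) (+ n ⊖ + k))))) / 1)
mainTheorem7 m@(suc _) n@(suc _) r (s≤s z≤n) (s≤s z≤n) _ =
  trans (sum1-summand m n r)
        (sym (rearrange (+ (m *ℕ n) / (2 *ℕ (m +ℕ n))) (ι c) (+ r / 2) (ι ((2 *ℕ m +ℕ 2 *ℕ n) C (m +ℕ n)))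
                        (ι (2 *ℕ V m n 0)) (ι (r *ℕ V m n 0)) (ι (W m n r)) (ι (W m n 0)) (Zℚ m n r)
                        mean central half (sum1-weights m n r)))
  where
  c = ((2 *ℕ m) C m) *ℕ ((2 *ℕ n) C n)
  mean : (+ (m *ℕ n) / (2 *ℕ (m +ℕ n))) * ι c ≡ ι (W m n 0)
  mean = ι-fraction (m *ℕ n) _ c (W m n 0) (first-moment m n)
  central : ι ((2 *ℕ m +ℕ 2 *ℕ n) C (m +ℕ n)) ≡ ι c + ι (2 *ℕ V m n 0)
  central = trans (cong ι (central-vandermonde m n)) (ι-+ c (2 *ℕ V m n 0))
  swap : ∀ r v → 2 *ℕ (r *ℕ v) ≡ r *ℕ (2 *ℕ v)
  swap = solve-∀
  half : (+ r / 2) * ι (2 *ℕ V m n 0) ≡ ι (r *ℕ V m n 0)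
  half = ι-fraction r 1 (2 *ℕ V m n 0) (r *ℕ V m n 0) (swap r (V m n 0))
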